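{- Let $G$ be a graph and $X,Y$ disjoint subsets of $V(G)$ such that $G$ is $X$–$Y$ normalized. Then each sequence $(S_1,\dots,S_r)$ of pairwise disjoint non-empty subsets of $V(G)$ is the attribute of at most one compound witness (w.r.t. $X,Y$ in $G$).
   Context: All graphs are finite, simple and undirected. $G\setminus C$ is the subgraph induced by $V(G)\setminus C$; $N(C)=(\bigcup_{v\in C}N(v))\setminus C$. An $X$–$Y$ separator is a set $K\subseteq V(G)\setminus(X\cup Y)$ such that $G\setminus K$ has no path from $X$ to $Y$; minimal means inclusion-minimal, smallest means of minimum cardinality. $NR(G,A,B)$ is the set of vertices of $G\setminus B$ not reachable from $A$ in $G\setminus B$. $K'>K$ means $NR(G,Y,K')\supsetneq NR(G,Y,K)$. A minimal $X$–$Y$ separator $K$ is important if no $X$–$Y$ separator $K'$ satisfies $K'>K$ and $|K'|\le|K|$. The excess of an $X$–$Y$ separator is its size minus the minimum size of an $X$–$Y$ separator. $G$ is $X$–$Y$ normalized if $N(X)$ is the only smallest $X$–$Y$ separator. For an $X$–$Y$ separator $K$, $Pr(G,X,Y,K)$ is the graph obtained from $G\setminus(NR(G,Y,K)\setminus X)$ by making every vertex of $X$ adjacent to every vertex of $K$. In an $X$–$Y$ normalized graph, for $S\subseteq N(X)$ with no vertex of $S$ adjacent to $Y$: the cover excess $CE(S)$ is the excess of a smallest $X$–$Y$ separator disjoint from $S$; a witness of $S$ is an $X$–$Y$ separator $K$ with $K\cap S=\emptyset$ and excess $CE(S)$; an important witness is a witness that is an important $X$–$Y$ separator; there is exactly one,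 denoted $K(S)$. Compound witness: for $G$ $X$–$Y$ normalized, a sequence $(S_1,\dots,S_r)$ of pairwise disjoint non-empty vertex sets and an $X$–$Y$ separator $K$: if $r=1$, $K$ is a compound witness of attribute $(S_1)$ if $S_1\subseteq N(X)$ and $K=K(S_1)$; if $r\ge2$, $K$ is a compound witness of attribute $(S_1,\dots,S_r)$ if $S_1\subseteq N(X)$ (with $K(S_1)$ defined), $S_2\cup\dots\cup S_r$ is disjoint from $N(X)$, and $K$ is a compound witness of $(S_2,\dots,S_r)$ w.r.t. $X,Y$ in the ($X$–$Y$ normalized) graph $Pr(G,X,Y,K(S_1))$. -}

module Defs where

open import Data.Nat using (ℕ; _≤_; _+_)
open import Data.Fin using (Fin)
open import Data.Fin.Subset using (Subset; _∈_; _∉_; _⊆_; _⊂_; ∣_∣; Nonempty; Empty; _∩_)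
open import Data.Product using (Σ; ∃; _×_; _,_)
open import Data.Sum using (_⊎_)
open import Data.List using (List; []; _∷_)
open import Data.List.Relation.Unary.All using (All)
open import Data.List.Relation.Unary.AllPairs using (AllPairs)
open import Relation.Nullary using (¬_)
open import Data.Empty using (⊥)
open import Relation.Binary.PropositionalEquality using (_≡_)

-- A graph on (a subset of) the finite ground set Fin n:
-- V is the vertex set (a predicate, so that induced subgraphs such as
-- G \ (NR \ X) can be formed without decidability), E the edge relation.
-- Only edges with both endpoints in V count (see Adj).
record Graph (n : ℕ) : Set₁ where
  constructor mkGraph
  field
    V : Fin n → Set
    E : Fin n → Fin n → Set
open Graph public

SimpleGraph : ∀ {n} → Graph n → Set
SimpleGraph G = (∀ u v → E G u v → E G v u) × (∀ u → ¬ E G u u)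

module _ {n : ℕ} where

  Adj : Graph n → Fin n → Fin n → Set
  Adj G u v = V G u × V G v × E G u v

  InV : Graph n → Subset n → Set
  InV G A = ∀ v → v ∈ A → V G v

  Disjoint : Subset n → Subset n → Set
  Disjoint A B = Empty (A ∩ B)

  data Reach (G : Graph n) (C : Subset n) (a : Fin n) : Fin n → Set where
    here : V G a → a ∉ C → Reach G C a a
    step : ∀ {b c} → Reach G C a b → Adj G b c → c ∉ C → Reach G C a c

  PathAvoiding : Graph n → Subset n → Subset n → Subset n → Set
  PathAvoiding G C A B = ∃ λ a → ∃ λ b → a ∈ A × b ∈ B × Reach G C a b

  N : Graph n → Subset n → Fin n → Set
  N G C u = (∃ λ v → v ∈ C × Adj G v u) × u ∉ C

  Separator : Graph n → Subset n → Subset n → Subset n → Set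
  Separator G X Y K =
    InV G K × Disjoint K X × Disjoint K Y × ¬ PathAvoiding G K X Y

  MinimalSep : Graph n → Subset n → Subset n → Subset n → Set
  MinimalSep G X Y K =
    Separator G X Y K × (∀ K' → K' ⊂ K → ¬ Separator G X Y K')

  SmallestSep : Graph n → Subset n → Subset n → Subset n → Set
  SmallestSep G X Y K =
    Separator G X Y K × (∀ K' → Separator G X Y K' → ∣ K ∣ ≤ ∣ K' ∣)

  NR : Graph n → Subset n → Subset n → Fin n → Set
  NR G A B v = V G v × v ∉ B × ¬ (∃ λ a → a ∈ A × Reach G B a v)

  Greater : Graph n → Subset n → Subset n → Subset n → Set
  Greater G Y K' K =
    (∀ v → NR G Y K v → NR G Y K' v) × (∃ λ v → NR G Y K' v × ¬ NR G Y K v)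

  ImportantSep : Graph n → Subset n → Subset n → Subset n → Set
  ImportantSep G X Y K =
    MinimalSep G X Y K ×
    ¬ (∃ λ K' → Separator G X Y K' × Greater G Y K' K × ∣ K' ∣ ≤ ∣ K ∣)

  MinSepSize : Graph n → Subset n → Subset n → ℕ → Set
  MinSepSize G X Y m = ∃ λ K → SmallestSep G X Y K × ∣ K ∣ ≡ m

  Excess : Graph n → Subset n → Subset n → Subset n → ℕ → Set
  Excess G X Y K e =
    Separator G X Y K × ∃ λ m → MinSepSize G X Y m × ∣ K ∣ ≡ m + e

  SameSet : Subset n → (Fin n → Set) → Set
  SameSet A P = ∀ v → (v ∈ A → P v) × (P v → v ∈ A)

  Normalized : Graph n → Subset n → Subset n → Set
  Normalized G X Y =
    (∃ λ K → SmallestSep G X Y K × SameSet K (N G X)) ×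
    (∀ K → SmallestSep G X Y K → SameSet K (N G X))

  CoverDomain : Graph n → Subset n → Subset n → Subset n → Set
  CoverDomain G X Y S =
    (∀ v → v ∈ S → N G X v) ×
    ¬ (∃ λ s → ∃ λ y → s ∈ S × y ∈ Y × Adj G s y)

  SmallestSepAvoiding : Graph n → Subset n → Subset n → Subset n → Subset n → Set
  SmallestSepAvoiding G X Y S K =
    Separator G X Y K × Disjoint K S ×
    (∀ K' → Separator G X Y K' → Disjoint K' S → ∣ K ∣ ≤ ∣ K' ∣)

  CoverExcess : Graph n → Subset n → Subset n → Subset n → ℕ → Set
  CoverExcess G X Y S e =
    CoverDomain G X Y S ×
    ∃ λ K → SmallestSepAvoiding G X Y S K × Excess G X Y K e

  Witness : Graph n → Subset n → Subset n → Subset n → Subset n → Set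
  Witness G X Y S K =
    Separator G X Y K × Disjoint K S ×
    ∃ λ e → CoverExcess G X Y S e × Excess G X Y K e

  ImportantWitness : Graph n → Subset n → Subset n → Subset n → Subset n → Set
  ImportantWitness G X Y S K =
    Normalized G X Y × Witness G X Y S K × ImportantSep G X Y K

  Pr : Graph n → Subset n → Subset n → Subset n → Graph n
  Pr G X Y K = mkGraph
    (λ v → V G v × ¬ (NR G Y K v × v ∉ X))
    (λ u v → E G u v ⊎ ((u ∈ X × v ∈ K) ⊎ (u ∈ K × v ∈ X)))

  PairwiseDisjointNonempty : List (Subset n) → Set
  PairwiseDisjointNonempty Ss = All Nonempty Ss × AllPairs Disjoint Ss

  CompoundWitness : Graph n → Subset n → Subset n → List (Subset n) → Subset n → Set
  CompoundWitness G X Y [] K = ⊥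
  CompoundWitness G X Y (S₁ ∷ []) K =
    Normalized G X Y × PairwiseDisjointNonempty (S₁ ∷ []) ×
    CoverDomain G X Y S₁ × ImportantWitness G X Y S₁ K
  CompoundWitness G X Y (S₁ ∷ S₂ ∷ Ss) K =
    Normalized G X Y × PairwiseDisjointNonempty (S₁ ∷ S₂ ∷ Ss) ×
    All (λ S → ∀ v → v ∈ S → ¬ N G X v) (S₂ ∷ Ss) ×
    ∃ λ K₁ → CoverDomain G X Y S₁ × ImportantWitness G X Y S₁ K₁ ×
             CompoundWitness (Pr G X Y K₁) X Y (S₂ ∷ Ss) K

module Submission where

-- The heart of the matter is that an important witness K(S) is unique.
-- Let K, K' be important witnesses of S, and let Q, Q' be the vertex sets
-- reachable from Y in G \ K and G \ K'.  Uncrossing gives the separators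
-- A = N(Q ∩ Q') and B = N(Q ∪ Q') with |A| + |B| ≤ |K| + |K'|.  Since B
-- avoids S, the witness K satisfies |K| ≤ |B|, hence |A| ≤ |K'|; moreover
-- NR(K) ⊆ NR(A) and NR(K') ⊆ NR(A), so importance of K' forces
-- NR(A) = NR(K') and therefore NR(K) ⊆ NR(K').  By symmetry NR(K) = NR(K'),
-- and a minimal separator is determined by its NR region, so K = K'.
-- A compound witness is then unique by induction on its attribute, since
-- each step moves to the graph Pr(G,X,Y,K(S₁)) determined by K(S₁).
--
-- The regions Q, Q', A, B are predicates on vertices; turning them into
-- subsets needs excluded middle, which is harmless because every use occurs
-- under a double negation.

open import Defs
open import Data.Nat using (ℕ; zero; suc; _+_; _≤_)
open import Data.Nat.Properties using (≤-antisym; ≤-trans; ≤-reflexive; +-suc; +-comm; +-mono-≤; +-monoˡ-≤; +-cancelʳ-≤; module ≤-Reasoning)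
open import Data.Fin using (Fin; zero; suc)
open import Data.Fin.Properties using (_≟_)
open import Data.Fin.Subset using (Subset; inside; outside; _∈_; _∉_; _⊆_; _∩_; _∪_; _-_; ⁅_⁆; ∣_∣)
open import Data.Fin.Subset.Properties using (_∈?_; x∈p∩q⁺; x∈p∩q⁻; x∈p∪q⁺; x∈p∪q⁻; p∩q⊆p; p∩q⊆q; p⊆q⇒∣p∣≤∣q∣; ⊆-antisym; p─q⊆p; x∈p⇒p-x⊂p; x∈p∧x≢y⇒x∈p-y)
open import Data.Vec using ([]; _∷_; here; there)
open import Data.List using (List; []; _∷_)
open import Data.Product using (∃; _×_; _,_; proj₁; proj₂)
open import Data.Sum using (_⊎_; inj₁; inj₂)
open import Data.Empty using (⊥; ⊥-elim)
open import Function using (_∘_)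
open import Relation.Nullary using (¬_; yes; no)
open import Relation.Nullary.Decidable using (decidable-stable; ¬¬-excluded-middle)
open import Relation.Binary.PropositionalEquality using (_≡_; refl; sym; trans; cong; subst; module ≡-Reasoning)

private
  variable
    n : ℕ
    G : Graph n
    A B C K K' S W X Y Z : Subset n
    a b c k v w x : Fin n
    e : ℕ

∣p∪q∣+∣p∩q∣≡∣p∣+∣q∣ : (p q : Subset n) → ∣ p ∪ q ∣ + ∣ p ∩ q ∣ ≡ ∣ p ∣ + ∣ q ∣
∣p∪q∣+∣p∩q∣≡∣p∣+∣q∣ [] [] = refl
∣p∪q∣+∣p∩q∣≡∣p∣+∣q∣ (inside ∷ p) (inside ∷ q) =
  cong suc (trans (+-suc (∣ p ∪ q ∣) (∣ p ∩ q ∣))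
                  (trans (cong suc (∣p∪q∣+∣p∩q∣≡∣p∣+∣q∣ p q)) (sym (+-suc (∣ p ∣) (∣ q ∣)))))
∣p∪q∣+∣p∩q∣≡∣p∣+∣q∣ (inside ∷ p) (outside ∷ q) = cong suc (∣p∪q∣+∣p∩q∣≡∣p∣+∣q∣ p q)
∣p∪q∣+∣p∩q∣≡∣p∣+∣q∣ (outside ∷ p) (inside ∷ q) =
  trans (cong suc (∣p∪q∣+∣p∩q∣≡∣p∣+∣q∣ p q)) (sym (+-suc (∣ p ∣) (∣ q ∣)))
∣p∪q∣+∣p∩q∣≡∣p∣+∣q∣ (outside ∷ p) (outside ∷ q) = ∣p∪q∣+∣p∩q∣≡∣p∣+∣q∣ p q

size-sum-mono : (A B C D : Subset n) → A ∪ B ⊆ C ∪ D → A ∩ B ⊆ C ∩ D →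
                ∣ A ∣ + ∣ B ∣ ≤ ∣ C ∣ + ∣ D ∣
size-sum-mono A B C D ∪⊆ ∩⊆ = begin
  ∣ A ∣ + ∣ B ∣         ≡⟨ sym (∣p∪q∣+∣p∩q∣≡∣p∣+∣q∣ A B) ⟩
  ∣ A ∪ B ∣ + ∣ A ∩ B ∣ ≤⟨ +-mono-≤ (p⊆q⇒∣p∣≤∣q∣ ∪⊆) (p⊆q⇒∣p∣≤∣q∣ ∩⊆) ⟩
  ∣ C ∪ D ∣ + ∣ C ∩ D ∣ ≡⟨ ∣p∪q∣+∣p∩q∣≡∣p∣+∣q∣ C D ⟩
  ∣ C ∣ + ∣ D ∣         ∎
  where open ≤-Reasoning

disjoint⁺ : (∀ {v} → v ∈ A → v ∈ B → ⊥) → Disjoint A B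
disjoint⁺ {A = A} {B = B} h (_ , v∈A∩B) = let (v∈A , v∈B) = x∈p∩q⁻ A B v∈A∩B in h v∈A v∈B

disjoint⁻ : Disjoint A B → v ∈ A → v ∈ B → ⊥
disjoint⁻ A∩B=∅ v∈A v∈B = A∩B=∅ (_ , x∈p∩q⁺ (v∈A , v∈B))

cover-disjoint : (∀ {v} → v ∈ C → v ∈ A ⊎ v ∈ B) → Disjoint A Z → Disjoint B Z → Disjoint C Z
cover-disjoint {A = A} {B = B} {Z = Z} cover A∩Z B∩Z = disjoint⁺ (avoid ∘ cover)
  where
  avoid : ∀ {v} → v ∈ A ⊎ v ∈ B → v ∉ Z
  avoid (inj₁ v∈A) = disjoint⁻ A∩Z v∈A
  avoid (inj₂ v∈B) = disjoint⁻ B∩Z v∈B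

subset-of : (P : Fin n → Set) → ¬ ¬ (∃ λ A → SameSet A P)
subset-of {zero} P use = use ([] , λ ())
subset-of {suc n} P use = subset-of (P ∘ suc) λ (A , A≡P∘suc) →
  ¬¬-excluded-middle λ where
    (yes P0) → use (inside ∷ A , λ where
      zero → (λ _ → P0) , (λ _ → here)
      (suc i) → extend A≡P∘suc i)
    (no ¬P0) → use (outside ∷ A , λ where
      zero → (λ ()) , (λ P0 → ⊥-elim (¬P0 P0))
      (suc i) → extend A≡P∘suc i)
  where
  extend : ∀ {A : Subset n} {x} → SameSet A (P ∘ suc) → ∀ i →
           (suc i ∈ (x ∷ A) → P (suc i)) × (P (suc i) → suc i ∈ (x ∷ A))
  extend A≡P∘suc i = (λ { (there i∈A) → proj₁ (A≡P∘suc i) i∈A }) , there ∘ proj₂ (A≡P∘suc i)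

Undirected : Graph n → Set
Undirected G = ∀ u v → E G u v → E G v u

Reachable : Graph n → Subset n → Subset n → Fin n → Set
Reachable G C A v = ∃ λ a → a ∈ A × Reach G C a v

Closed : Graph n → Subset n → Subset n → Set
Closed G C W = ∀ {w c} → w ∈ W → Adj G w c → c ∉ C → c ∈ W

reach-end : Reach G C a b → V G b × b ∉ C
reach-end (here b∈V b∉C) = b∈V , b∉C
reach-end (step _ (_ , c∈V , _) c∉C) = c∈V , c∉C

reach-trans : Reach G C a b → Reach G C b c → Reach G C a c
reach-trans r (here _ _) = r
reach-trans r (step r' adj c∉C) = step (reach-trans r r') adj c∉C

reach-sym : Undirected G → Reach G C a b → Reach G C b a
reach-sym undirected (here a∈V a∉C) = here a∈V a∉C
reach-sym undirected (step r (b∈V , c∈V , e) c∉C) =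
  reach-trans (step (here c∈V c∉C) (c∈V , b∈V , undirected _ _ e) (proj₂ (reach-end r)))
              (reach-sym undirected r)

reach-closed : Closed G C W → Reach G C a b → a ∈ W → b ∈ W
reach-closed closed (here _ _) a∈W = a∈W
reach-closed closed (step r adj c∉C) a∈W = closed (reach-closed closed r a∈W) adj c∉C

boundary-closed : SameSet C (N G W) → Closed G C W
boundary-closed {C = C} {W = W} C≡N {w} {c} w∈W adj c∉C with c ∈? W
... | yes c∈W = c∈W
... | no c∉W = ⊥-elim (c∉C (proj₂ (C≡N c) ((w , w∈W , adj) , c∉W)))

first-entry : Reach G (K - k) a b → a ∉ K →
              Reach G K a b ⊎ ∃ λ u → Reach G K a u × Adj G u k
first-entry (here a∈V _) a∉K = inj₁ (here a∈V a∉K)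
first-entry (step r adj c∉K-k) a∉K with first-entry r a∉K
... | inj₂ entry = inj₂ entry
first-entry {k = k} (step {c = c} r adj c∉K-k) a∉K | inj₁ r' with c ≟ k
... | yes refl = inj₂ (_ , r' , adj)
... | no c≢k = inj₁ (step r' adj (λ c∈K → c∉K-k (x∈p∧x≢y⇒x∈p-y c∈K c≢k)))

sep-avoids-X : Separator G X Y K → v ∈ K → v ∉ X
sep-avoids-X (_ , K∩X , _) = disjoint⁻ K∩X

sep-blocks : Separator G X Y K → a ∈ X → b ∈ Y → ¬ Reach G K a b
sep-blocks (_ , _ , _ , no-path) a∈X b∈Y r = no-path (_ , _ , a∈X , b∈Y , r)

boundary-separator : Undirected G → SameSet C (N G W) → Disjoint C X →
                     Y ⊆ W → (∀ {x} → x ∈ X → x ∉ W) → Separator G X Y C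
boundary-separator {G = G} {C = C} {W = W} {X = X} {Y = Y} undirected C≡N C∩X Y⊆W X∉W =
  C⊆V , C∩X , disjoint⁺ C∉Y , no-path
  where
  C⊆V : InV G C
  C⊆V v v∈C with proj₁ (C≡N v) v∈C
  ... | (_ , _ , _ , v∈V , _) , _ = v∈V
  C∉Y : ∀ {v} → v ∈ C → v ∈ Y → ⊥
  C∉Y v∈C v∈Y = proj₂ (proj₁ (C≡N _) v∈C) (Y⊆W v∈Y)
  no-path : ¬ PathAvoiding G C X Y
  no-path (_ , _ , a∈X , b∈Y , r) =
    X∉W a∈X (reach-closed (boundary-closed C≡N) (reach-sym undirected r) (Y⊆W b∈Y))

module Region {G : Graph n} {Y K Q : Subset n} (Q≡reach : SameSet Q (Reachable G K Y)) where

  Q-closed : Closed G K Q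
  Q-closed w∈Q adj c∉K with proj₁ (Q≡reach _) w∈Q
  ... | y , y∈Y , r = proj₂ (Q≡reach _) (y , y∈Y , step r adj c∉K)

  exit-in-K : w ∈ Q → Adj G w c → c ∉ Q → c ∈ K
  exit-in-K {c = c} w∈Q adj c∉Q with c ∈? K
  ... | yes c∈K = c∈K
  ... | no c∉K = ⊥-elim (c∉Q (Q-closed w∈Q adj c∉K))

  NR-grows : W ⊆ Q → Y ⊆ W → SameSet C (N G W) → ∀ v → NR G Y K v → NR G Y C v
  NR-grows {W = W} {C = C} W⊆Q Y⊆W C≡N v (v∈V , v∉K , unreachable) =
    v∈V , v∉C , unreachable-C
    where
    v∉C : v ∉ C
    v∉C v∈C with proj₁ (C≡N v) v∈C
    ... | (w , w∈W , adj) , _ = unreachable (proj₁ (Q≡reach v) (Q-closed (W⊆Q w∈W) adj v∉K))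
    unreachable-C : ¬ Reachable G C Y v
    unreachable-C (y , y∈Y , r) =
      unreachable (proj₁ (Q≡reach v) (W⊆Q (reach-closed (boundary-closed C≡N) r (Y⊆W y∈Y))))

  module _ {X : Subset n} (sepK : Separator G X Y K) where

    Y⊆Q : InV G Y → Y ⊆ Q
    Y⊆Q Y⊆V y∈Y = proj₂ (Q≡reach _)
      (_ , y∈Y , here (Y⊆V _ y∈Y) (λ y∈K → disjoint⁻ (proj₁ (proj₂ (proj₂ sepK))) y∈K y∈Y))

    X∉Q : Undirected G → x ∈ X → x ∉ Q
    X∉Q undirected x∈X x∈Q with proj₁ (Q≡reach _) x∈Q
    ... | y , y∈Y , r = sep-blocks sepK x∈X y∈Y (reach-sym undirected r)

module Uncrossing {G : Graph n} (undirected : Undirected G) {X Y : Subset n} (Y⊆V : InV G Y)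
  {K K' Q Q' A B : Subset n} (sepK : Separator G X Y K) (sepK' : Separator G X Y K')
  (Q≡reach : SameSet Q (Reachable G K Y)) (Q'≡reach : SameSet Q' (Reachable G K' Y))
  (A≡N : SameSet A (N G (Q ∩ Q'))) (B≡N : SameSet B (N G (Q ∪ Q'))) where

  private
    module R = Region Q≡reach
    module R' = Region Q'≡reach

  Y⊆Q∩Q' : Y ⊆ Q ∩ Q'
  Y⊆Q∩Q' y∈Y = x∈p∩q⁺ (R.Y⊆Q sepK Y⊆V y∈Y , R'.Y⊆Q sepK' Y⊆V y∈Y)

  Y⊆Q∪Q' : Y ⊆ Q ∪ Q'
  Y⊆Q∪Q' y∈Y = x∈p∪q⁺ (inj₁ (R.Y⊆Q sepK Y⊆V y∈Y))

  X∉Q∩Q' : x ∈ X → x ∉ Q ∩ Q'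
  X∉Q∩Q' x∈X x∈Q∩Q' = R.X∉Q sepK undirected x∈X (p∩q⊆p Q Q' x∈Q∩Q')

  X∉Q∪Q' : x ∈ X → x ∉ Q ∪ Q'
  X∉Q∪Q' x∈X x∈Q∪Q' with x∈p∪q⁻ Q Q' x∈Q∪Q'
  ... | inj₁ x∈Q = R.X∉Q sepK undirected x∈X x∈Q
  ... | inj₂ x∈Q' = R'.X∉Q sepK' undirected x∈X x∈Q'

  outside-union : v ∉ Q ∪ Q' → v ∉ Q × v ∉ Q'
  outside-union v∉Q∪Q' = v∉Q∪Q' ∘ x∈p∪q⁺ ∘ inj₁ , v∉Q∪Q' ∘ x∈p∪q⁺ ∘ inj₂

  A⊆K∪K' : v ∈ A → v ∈ K ⊎ v ∈ K'
  A⊆K∪K' {v = v} v∈A with proj₁ (A≡N v) v∈A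
  ... | (w , w∈Q∩Q' , adj) , v∉Q∩Q' with x∈p∩q⁻ Q Q' w∈Q∩Q' | v ∈? Q
  ... | w∈Q , _   | no v∉Q = inj₁ (R.exit-in-K w∈Q adj v∉Q)
  ... | _  , w∈Q' | yes v∈Q = inj₂ (R'.exit-in-K w∈Q' adj (λ v∈Q' → v∉Q∩Q' (x∈p∩q⁺ (v∈Q , v∈Q'))))

  B⊆K∪K' : v ∈ B → v ∈ K ⊎ v ∈ K'
  B⊆K∪K' {v = v} v∈B with proj₁ (B≡N v) v∈B
  ... | (w , w∈Q∪Q' , adj) , v∉Q∪Q' with x∈p∪q⁻ Q Q' w∈Q∪Q'
  ... | inj₁ w∈Q = inj₁ (R.exit-in-K w∈Q adj (proj₁ (outside-union v∉Q∪Q')))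
  ... | inj₂ w∈Q' = inj₂ (R'.exit-in-K w∈Q' adj (proj₂ (outside-union v∉Q∪Q')))

  A∩B⊆K∩K' : A ∩ B ⊆ K ∩ K'
  A∩B⊆K∩K' {v} v∈A∩B with x∈p∩q⁻ A B v∈A∩B
  ... | v∈A , v∈B with proj₁ (A≡N v) v∈A | proj₁ (B≡N v) v∈B
  ... | (w , w∈Q∩Q' , adj) , _ | _ , v∉Q∪Q' with x∈p∩q⁻ Q Q' w∈Q∩Q'
  ... | w∈Q , w∈Q' = x∈p∩q⁺ ( R.exit-in-K w∈Q adj (proj₁ (outside-union v∉Q∪Q'))
                            , R'.exit-in-K w∈Q' adj (proj₂ (outside-union v∉Q∪Q')))

  A∪B⊆K∪K' : A ∪ B ⊆ K ∪ K'
  A∪B⊆K∪K' v∈A∪B with x∈p∪q⁻ A B v∈A∪B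
  ... | inj₁ v∈A = x∈p∪q⁺ (A⊆K∪K' v∈A)
  ... | inj₂ v∈B = x∈p∪q⁺ (B⊆K∪K' v∈B)

  meet-separator : Separator G X Y A
  meet-separator = boundary-separator undirected A≡N
    (cover-disjoint A⊆K∪K' (proj₁ (proj₂ sepK)) (proj₁ (proj₂ sepK'))) Y⊆Q∩Q' X∉Q∩Q'

  join-separator : Separator G X Y B
  join-separator = boundary-separator undirected B≡N
    (cover-disjoint B⊆K∪K' (proj₁ (proj₂ sepK)) (proj₁ (proj₂ sepK'))) Y⊆Q∪Q' X∉Q∪Q'

  submodular : ∣ A ∣ + ∣ B ∣ ≤ ∣ K ∣ + ∣ K' ∣
  submodular = size-sum-mono A B K K' A∪B⊆K∪K' A∩B⊆K∩K'

  NR-meet-left : ∀ v → NR G Y K v → NR G Y A v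
  NR-meet-left = R.NR-grows (p∩q⊆p Q Q') Y⊆Q∩Q' A≡N

  NR-meet-right : ∀ v → NR G Y K' v → NR G Y A v
  NR-meet-right = R'.NR-grows (p∩q⊆q Q Q') Y⊆Q∩Q' A≡N

min-size-unique : ∀ {m m'} → MinSepSize G X Y m → MinSepSize G X Y m' → m ≡ m'
min-size-unique (K , (sepK , K-min) , refl) (K' , (sepK' , K'-min) , refl) =
  ≤-antisym (K-min K' sepK') (K'-min K sepK)

same-excess-same-size : Excess G X Y K e → Excess G X Y K' e → ∣ K ∣ ≡ ∣ K' ∣
same-excess-same-size {K = K} {e = e} {K' = K'} (_ , m , min-m , K≡m+e) (_ , m' , min-m' , K'≡m'+e) =
  begin
    ∣ K ∣   ≡⟨ K≡m+e ⟩
    m + e   ≡⟨ cong (_+ e) (min-size-unique min-m min-m') ⟩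
    m' + e  ≡⟨ sym K'≡m'+e ⟩
    ∣ K' ∣  ∎
  where open ≡-Reasoning

witness-smallest : Witness G X Y S K → Separator G X Y W → Disjoint W S → ∣ K ∣ ≤ ∣ W ∣
witness-smallest (_ , _ , _ , (_ , K₀ , (_ , _ , K₀-smallest) , excess-K₀) , excess-K) sepW W∩S =
  ≤-trans (≤-reflexive (same-excess-same-size excess-K excess-K₀)) (K₀-smallest _ sepW W∩S)

important-NR-maximal : ImportantSep G X Y K → Separator G X Y A → ∣ A ∣ ≤ ∣ K ∣ →
                       (∀ v → NR G Y K v → NR G Y A v) → ∀ v → NR G Y A v → ¬ ¬ NR G Y K v
important-NR-maximal (_ , no-greater) sepA A≤K K⊆A v v∈A v∉K =
  no-greater (_ , sepA , (K⊆A , v , v∈A , v∉K) , A≤K)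

important-witnesses-NR : Undirected G → InV G Y →
  ImportantWitness G X Y S K → ImportantWitness G X Y S K' →
  ∀ v → NR G Y K v → ¬ ¬ NR G Y K' v
important-witnesses-NR {G = G} {Y = Y} {K = K} {K' = K'} undirected Y⊆V
  (_ , witK@(sepK , K∩S , _) , _) (_ , (sepK' , K'∩S , _) , importantK') v v∈NR v∉NR' =
  subset-of (Reachable G K Y) λ (Q , Q≡reach) →
  subset-of (Reachable G K' Y) λ (Q' , Q'≡reach) →
  subset-of (N G (Q ∩ Q')) λ (A , A≡N) →
  subset-of (N G (Q ∪ Q')) λ (B , B≡N) →
  let open Uncrossing undirected Y⊆V sepK sepK' Q≡reach Q'≡reach A≡N B≡N
      K≤B : ∣ K ∣ ≤ ∣ B ∣
      K≤B = witness-smallest witK join-separator (cover-disjoint B⊆K∪K' K∩S K'∩S)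
      A+B≤K'+B : ∣ A ∣ + ∣ B ∣ ≤ ∣ K' ∣ + ∣ B ∣
      A+B≤K'+B = ≤-trans submodular
                   (≤-trans (+-monoˡ-≤ ∣ K' ∣ K≤B) (≤-reflexive (+-comm (∣ B ∣) (∣ K' ∣))))
  in important-NR-maximal importantK' meet-separator (+-cancelʳ-≤ (∣ B ∣) (∣ A ∣) (∣ K' ∣) A+B≤K'+B)
       NR-meet-right v (NR-meet-left v v∈NR) v∉NR'

essential-vertex : MinimalSep G X Y K → k ∈ K → ¬ ¬ PathAvoiding G (K - k) X Y
essential-vertex {K = K} {k = k} ((K⊆V , K∩X , K∩Y , _) , minimal) k∈K no-path =
  minimal (K - k) (x∈p⇒p-x⊂p k∈K)
    ( (λ v → K⊆V v ∘ shrink)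
    , disjoint⁺ (disjoint⁻ K∩X ∘ shrink)
    , disjoint⁺ (disjoint⁻ K∩Y ∘ shrink)
    , no-path)
  where
  shrink : ∀ {v} → v ∈ K - k → v ∈ K
  shrink = p─q⊆p K ⁅ k ⁆

minimal-separator-⊆ : Undirected G → MinimalSep G X Y K →
  (∀ v → NR G Y K v → ¬ ¬ NR G Y K' v) → (∀ v → NR G Y K' v → ¬ ¬ NR G Y K v) → K ⊆ K'
minimal-separator-⊆ {G = G} {X = X} {Y = Y} {K = K} {K' = K'} undirected minK NR⊆NR' NR'⊆NR {k} k∈K =
  decidable-stable (k ∈? K') λ k∉K' → essential-vertex minK k∈K (no-reopened-path k∉K')
  where
  sepK : Separator G X Y K
  sepK = proj₁ minK
  no-reopened-path : k ∉ K' → ¬ PathAvoiding G (K - k) X Y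
  no-reopened-path k∉K' (x , y , x∈X , y∈Y , r) with first-entry r (λ x∈K → sep-avoids-X sepK x∈K x∈X)
  ... | inj₁ r' = sep-blocks sepK x∈X y∈Y r'
  ... | inj₂ (u , x→u , u∈V , k∈V , e) =
    NR⊆NR' u u∈NR λ u∈NR' → NR'⊆NR k (k∈V , k∉K' , k-unreachable u∈NR') λ k∈NR → proj₁ (proj₂ k∈NR) k∈K
    where
    -- u is reached from X avoiding K, so it cannot be reached from Y.
    u∈NR : NR G Y K u
    u∈NR = u∈V , proj₂ (reach-end x→u) , λ (y' , y'∈Y , y'→u) →
      sep-blocks sepK x∈X y'∈Y (reach-trans x→u (reach-sym undirected y'→u))
    -- k is adjacent to u, so reaching k avoiding K' would reach u as well.
    k-unreachable : NR G Y K' u → ¬ Reachable G K' Y k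
    k-unreachable (_ , u∉K' , u-unreachable) (y' , y'∈Y , y'→k) =
      u-unreachable (y' , y'∈Y , step y'→k (k∈V , u∈V , undirected _ _ e) u∉K')

important-witness-unique : Undirected G → InV G Y →
  ImportantWitness G X Y S K → ImportantWitness G X Y S K' → K ≡ K'
important-witness-unique {G = G} {Y = Y} {X = X} {S = S} undirected Y⊆V wK wK' =
  ⊆-antisym (inclusion wK wK') (inclusion wK' wK)
  where
  inclusion : ∀ {J J'} → ImportantWitness G X Y S J → ImportantWitness G X Y S J' → J ⊆ J'
  inclusion w@(_ , _ , minimal , _) w' = minimal-separator-⊆ undirected minimal
    (important-witnesses-NR undirected Y⊆V w w') (important-witnesses-NR undirected Y⊆V w' w)

Pr-undirected : Undirected G → Undirected (Pr G X Y K)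
Pr-undirected undirected u v (inj₁ e) = inj₁ (undirected u v e)
Pr-undirected undirected u v (inj₂ (inj₁ (u∈X , v∈K))) = inj₂ (inj₂ (v∈K , u∈X))
Pr-undirected undirected u v (inj₂ (inj₂ (u∈K , v∈X))) = inj₂ (inj₁ (v∈X , u∈K))

Pr-contains-Y : InV G Y → InV (Pr G X Y K) Y
Pr-contains-Y Y⊆V y y∈Y = Y⊆V y y∈Y , λ ((_ , y∉K , unreachable) , _) →
  unreachable (y , y∈Y , here (Y⊆V y y∈Y) y∉K)

compound-witness-unique : Undirected G → InV G Y → (Ss : List (Subset n)) →
  CompoundWitness G X Y Ss K → CompoundWitness G X Y Ss K' → K ≡ K'
compound-witness-unique undirected Y⊆V [] () _
compound-witness-unique undirected Y⊆V (S ∷ []) (_ , _ , _ , wK) (_ , _ , _ , wK') =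
  important-witness-unique undirected Y⊆V wK wK'
compound-witness-unique {G = G} {Y = Y} {X = X} {K' = K'} undirected Y⊆V (S₁ ∷ S₂ ∷ Ss)
  (_ , _ , _ , K₁ , _ , wK₁ , cK) (_ , _ , _ , K₁' , _ , wK₁' , cK') =
  compound-witness-unique {G = Pr G X Y K₁}
    (Pr-undirected {G = G} {X = X} {Y = Y} {K = K₁} undirected) (Pr-contains-Y Y⊆V) (S₂ ∷ Ss)
    cK (subst (λ J → CompoundWitness (Pr G X Y J) X Y (S₂ ∷ Ss) K') (sym K₁≡K₁') cK')
  where
  -- the first step K(S₁) is unique, so both witnesses continue in the same graph
  K₁≡K₁' : K₁ ≡ K₁'
  K₁≡K₁' = important-witness-unique undirected Y⊆V wK₁ wK₁'

corollary13 : ∀ {n : ℕ} (G : Graph n) (X Y : Subset n) →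
    SimpleGraph G → InV G X → InV G Y → Disjoint X Y →
    Normalized G X Y →
    (Ss : List (Subset n)) → PairwiseDisjointNonempty Ss →
    (K K' : Subset n) →
    CompoundWitness G X Y Ss K → CompoundWitness G X Y Ss K' → K ≡ K'
corollary13 G X Y (undirected , _) _ Y⊆V _ _ Ss _ K K' =
  compound-witness-unique undirected Y⊆V Ss
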